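{- For every integer $n\geq 4$, the complete graph $K_n$ is total prime.
   Context: All graphs are finite and simple. For a graph $G$ with vertex set $V$ and edge set $E$, a total prime labeling is a bijection $\ell: V\cup E\to\{1,2,\ldots,|V|+|E|\}$ such that (i) for every pair of adjacent vertices $u,v$, $\gcd(\ell(u),\ell(v))=1$, and (ii) for every vertex $v$ of degree at least 2, the greatest common divisor of the labels $\ell(uv)$ over all edges $uv$ incident to $v$ equals 1. A graph is total prime if it admits a total prime labeling. -}

module Defs where

open import Data.Nat using (ℕ; suc; _+_; _<?_; _≤_)
open import Data.Nat.GCD using (gcd)
open import Data.Fin using (Fin; toℕ; _≟_)
open import Data.Fin.Properties using ()
open import Data.List using (List; length; lookup; filter; foldr; map; concatMap; allFin)
open import Data.Product using (_×_; _,_; proj₁; proj₂)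
open import Data.Sum using (_⊎_; inj₁; inj₂)
open import Relation.Binary.PropositionalEquality using (_≡_)
open import Relation.Nullary.Decidable using (_⊎-dec_)
open import Function.Bundles using (_↔_; Inverse)

-- A finite simple graph on vertex set Fin n, given by its list of edges.
-- Each edge is stored once as an ordered pair (u , v) with toℕ u < toℕ v.
record Graph : Set where
  field
    order : ℕ
    edges : List (Fin order × Fin order)

open Graph public

size : Graph → ℕ
size G = length (edges G)

Vertex : Graph → Set
Vertex G = Fin (order G)

Edge : Graph → Set
Edge G = Fin (size G)

endpoints : (G : Graph) → Edge G → Vertex G × Vertex G
endpoints G e = lookup (edges G) e

incident : (G : Graph) → Vertex G → List (Edge G)
incident G v = filter (λ e → (proj₁ (endpoints G e) ≟ v) ⊎-dec (proj₂ (endpoints G e) ≟ v)) (allFin (size G))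

degree : (G : Graph) → Vertex G → ℕ
degree G v = length (incident G v)

gcdList : List ℕ → ℕ
gcdList = foldr gcd 0

-- A total prime labeling: a bijection from V ⊎ E onto {1, …, |V|+|E|},
-- realised as a bijection onto Fin (|V|+|E|) followed by k ↦ k+1.
record TotalPrimeLabeling (G : Graph) : Set where
  field
    bij : (Vertex G ⊎ Edge G) ↔ Fin (order G + size G)
  label : Vertex G ⊎ Edge G → ℕ
  label x = suc (toℕ (Inverse.to bij x))
  field
    adjacentCoprime : (e : Edge G) →
      gcd (label (inj₁ (proj₁ (endpoints G e)))) (label (inj₁ (proj₂ (endpoints G e)))) ≡ 1
    incidentCoprime : (v : Vertex G) → 2 ≤ degree G v →
      gcdList (map (λ e → label (inj₂ e)) (incident G v)) ≡ 1

TotalPrime : Graph → Set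
TotalPrime G = TotalPrimeLabeling G

K : ℕ → Graph
K n = record
  { order = n
  ; edges = concatMap (λ i → map (i ,_) (filter (λ j → toℕ i <? toℕ j) (allFin n))) (allFin n)
  }

-- Label vertex 0 of K_n by 1 and the other n − 1 vertices by distinct primes below
-- m = n C 2, the number of edges; adjacent vertices then get coprime labels. The n + 1
-- largest labels m, …, m + n go to the edge {0, 2}, the path edges {u, u + 1} (label
-- m + u + 1) and the edge {0, n − 1}, so that every vertex lies on two edges with
-- consecutive, hence coprime, labels; any bijection extending this partial assignment
-- is a total prime labelling.
--
-- The n − 1 primes exist by a Chebyshev-type bound: k·C(2k, k) ≥ 4^k / 2 divides every
-- common multiple of k, …, 2k (a consequence of Leibniz's harmonic triangle), in
-- particular the product of the largest prime powers up to 2k, which is at most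
-- (2k)^π(2k). Taking 2k = 2b(b + 1) ≤ 2^b gives π(2b(b + 1)) ≥ 2b + 2 for b ≥ 7; the
-- remaining cases n < 16 are checked by computation.

module Submission where

open import Defs
open import Data.Bool using (true; false)
open import Data.Empty using (⊥-elim)
open import Data.Fin using (Fin; zero; suc; toℕ; _≟_; fromℕ; fromℕ<; inject₁; inject≤)
open import Data.Fin.Permutation using (transpose)
import Data.Fin.Permutation.Components as PC
open import Data.Fin.Properties using (all?; toℕ-inject₁; toℕ-fromℕ; toℕ-fromℕ<; toℕ<n; toℕ-injective; +↔⊎; inject≤-injective)
import Data.Fin.Properties as Fin
open import Data.Fin.Relation.Unary.Top using (view; ‵fromℕ; ‵inject₁)
open import Data.List using (List; []; _∷_; length; map; filter; allFin; tabulate; concatMap; downFrom; lookup)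
open import Data.List.Membership.Propositional using (_∈_)
open import Data.List.Membership.Propositional.Properties
  using (∈-concat⁺′; ∈-concat⁻′; ∈-map⁺; ∈-map⁻; ∈-filter⁺; ∈-filter⁻; ∈-allFin; ∈-lookup; ∈-downFrom⁻)
open import Data.List.Properties using (length-map; length-++; length-tabulate; map-tabulate; map-cong; filter-all; filter-≐)
open import Data.List.Relation.Unary.All as All using (_∷_)
import Data.List.Relation.Unary.All.Properties as All
open import Data.List.Relation.Unary.AllPairs using (_∷_)
open import Data.List.Relation.Unary.Any using (here; there; index)
open import Data.List.Relation.Unary.Any.Properties using (lookup-index)
open import Data.List.Relation.Unary.Unique.Propositional using (Unique)
import Data.List.Relation.Unary.Unique.Propositional.Properties as Unique
open import Data.Nat hiding (_≟_)
open import Data.Nat.Combinatorics using (_C_; nCk+nC[k+1]≡[n+1]C[k+1]; nCk≡nC[n∸k]; nCn≡1; nC1≡n)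
open import Data.Nat.Coprimality using (Coprime; coprime⇒gcd≡1; prime⇒coprime)
import Data.Nat.Coprimality as Coprime
open import Data.Nat.DivMod using (_/_; m/n<m; m/n*n≤m; m≥n⇒m/n>0; m*n/n≡m; /-monoˡ-≤)
open import Data.Nat.Divisibility
  using (_∣_; _∤_; _∣?_; divides; ∣-trans; ∣⇒≤; m∣m*n; *-pres-∣; *-monoʳ-∣; 1∣_; ∣m+n∣m⇒∣n; ∣1⇒≡1)
open import Data.Nat.GCD using (gcd; gcd-zeroˡ; gcd-zeroʳ; gcd[m,n]∣m; gcd[m,n]∣n)
open import Data.Nat.Induction using (<-wellFounded)
open import Data.Nat.ListAction using (sum; product)
open import Data.Nat.Primality using (Prime; prime?; prime⇒nonTrivial)
open import Data.Nat.Primality.Factorisation using (factorise)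
open import Data.Nat.Properties hiding (_≟_)
open import Algebra.Properties.CommutativeSemigroup *-commutativeSemigroup using (x∙yz≈y∙xz)
open import Data.Nat.Tactic.RingSolver using (solve-∀)
open import Data.Product using (Σ-syntax; ∃; ∃₂; ∃-syntax; _×_; _,_; proj₁; proj₂)
open import Data.Sum using (_⊎_; inj₁; inj₂; [_,_]; map₂)
import Data.Sum.Properties as Sum
open import Function using (_∘_)
open import Function.Bundles using (_↔_; Inverse; Injection)
open import Function.Construct.Composition using (_↔-∘_)
open import Function.Construct.Symmetry using (↔-sym)
open import Function.Definitions using (Injective)
open import Function.Properties.Inverse using (Inverse⇒Injection)
open import Induction.WellFounded using (Acc; acc)
open import Relation.Binary.Definitions using (tri<; tri≈; tri>)
open import Relation.Binary.PropositionalEquality hiding ([_])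
open import Relation.Nullary using (Dec; does; yes; no)
open import Relation.Nullary.Decidable using (_⊎-dec_; toWitness; dec-true; dec-false)

-- Binomial coefficients and Leibniz's harmonic triangle

[1+k]*[1+n]C[1+k]≡[1+n]*nCk : ∀ n k → suc k * (suc n C suc k) ≡ suc n * (n C k)
[1+k]*[1+n]C[1+k]≡[1+n]*nCk zero    zero    = refl
[1+k]*[1+n]C[1+k]≡[1+n]*nCk zero    (suc k) = *-zeroʳ (suc (suc k))
[1+k]*[1+n]C[1+k]≡[1+n]*nCk (suc n) zero    = begin
  1 * (suc (suc n) C 1)  ≡⟨ *-identityˡ _ ⟩
  suc (suc n) C 1        ≡⟨ nC1≡n (suc (suc n)) ⟩
  suc (suc n)            ≡⟨ *-identityʳ (suc (suc n)) ⟨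
  suc (suc n) * 1        ∎
  where open ≡-Reasoning
[1+k]*[1+n]C[1+k]≡[1+n]*nCk (suc n) (suc k) = begin
  suc (suc k) * (suc (suc n) C suc (suc k))
    ≡⟨ cong (suc (suc k) *_) (nCk+nC[k+1]≡[n+1]C[k+1] (suc n) (suc k)) ⟨
  suc (suc k) * (suc n C suc k + suc n C suc (suc k))
    ≡⟨ distribute k (suc n C suc k) (suc n C suc (suc k)) ⟩
  suc n C suc k + suc k * (suc n C suc k) + suc (suc k) * (suc n C suc (suc k))
    ≡⟨ cong₂ (λ x y → suc n C suc k + x + y) ([1+k]*[1+n]C[1+k]≡[1+n]*nCk n k) ([1+k]*[1+n]C[1+k]≡[1+n]*nCk n (suc k)) ⟩
  suc n C suc k + suc n * (n C k) + suc n * (n C suc k)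
    ≡⟨ cong (λ x → x + suc n * (n C k) + suc n * (n C suc k)) (nCk+nC[k+1]≡[n+1]C[k+1] n k) ⟨
  (n C k + n C suc k) + suc n * (n C k) + suc n * (n C suc k)
    ≡⟨ collect n (n C k) (n C suc k) ⟩
  suc (suc n) * (n C k + n C suc k)
    ≡⟨ cong (suc (suc n) *_) (nCk+nC[k+1]≡[n+1]C[k+1] n k) ⟩
  suc (suc n) * (suc n C suc k)
    ∎
  where
  open ≡-Reasoning
  distribute : ∀ k x y → suc (suc k) * (x + y) ≡ x + suc k * x + suc (suc k) * y
  distribute = solve-∀
  collect : ∀ n x y → (x + y) + suc n * x + suc n * y ≡ suc (suc n) * (x + y)
  collect = solve-∀

[m+n]Cm≡[m+n]Cn : ∀ m n → (m + n) C m ≡ (m + n) C n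
[m+n]Cm≡[m+n]Cn m n = trans (nCk≡nC[n∸k] (m≤m+n m n)) (cong ((m + n) C_) (m+n∸m≡n m n))

[1+n]C2≡n+nC2 : ∀ n → suc n C 2 ≡ n + n C 2
[1+n]C2≡n+nC2 n = trans (sym (nCk+nC[k+1]≡[n+1]C[k+1] n 1)) (cong (_+ n C 2) (nC1≡n n))

2*[1+n]C2≡[1+n]*n : ∀ n → 2 * (suc n C 2) ≡ suc n * n
2*[1+n]C2≡[1+n]*n zero    = refl
2*[1+n]C2≡[1+n]*n (suc n) = begin
  2 * (suc (suc n) C 2)          ≡⟨ cong (2 *_) ([1+n]C2≡n+nC2 (suc n)) ⟩
  2 * (suc n + suc n C 2)        ≡⟨ *-distribˡ-+ 2 (suc n) (suc n C 2) ⟩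
  2 * suc n + 2 * (suc n C 2)    ≡⟨ cong (2 * suc n +_) (2*[1+n]C2≡[1+n]*n n) ⟩
  2 * suc n + suc n * n          ≡⟨ regroup n ⟩
  suc (suc n) * suc n            ∎
  where
  open ≡-Reasoning
  regroup : ∀ n → 2 * suc n + suc n * n ≡ suc (suc n) * suc n
  regroup = solve-∀

nC2≤[1+n]C2 : ∀ n → n C 2 ≤ suc n C 2
nC2≤[1+n]C2 n = ≤-trans (m≤n+m (n C 2) n) (≤-reflexive (sym ([1+n]C2≡n+nC2 n)))

-- leibniz r m = m · C(m + r, m) is the reciprocal of the entry L(m + r − 1, m − 1) of
-- Leibniz's harmonic triangle, L(a, b) = 1 / ((a + 1) · C(a, b)).
leibniz : ℕ → ℕ → ℕ
leibniz r m = m * ((m + r) C m)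

leibniz-sucʳ : ∀ r m → m * leibniz r (suc m) ≡ suc (m + r) * leibniz r m
leibniz-sucʳ r m = begin
  m * (suc m * (suc (m + r) C suc m))  ≡⟨ cong (m *_) ([1+k]*[1+n]C[1+k]≡[1+n]*nCk (m + r) m) ⟩
  m * (suc (m + r) * ((m + r) C m))    ≡⟨ x∙yz≈y∙xz m (suc (m + r)) _ ⟩
  suc (m + r) * leibniz r m            ∎
  where open ≡-Reasoning

leibniz-sucˡ : ∀ r m → suc r * leibniz (suc r) m ≡ suc (m + r) * leibniz r m
leibniz-sucˡ r m = begin
  suc r * (m * ((m + suc r) C m))        ≡⟨ cong (λ x → suc r * (m * x)) ([m+n]Cm≡[m+n]Cn m (suc r)) ⟩
  suc r * (m * ((m + suc r) C suc r))    ≡⟨ cong (λ x → suc r * (m * (x C suc r))) (+-suc m r) ⟩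
  suc r * (m * (suc (m + r) C suc r))    ≡⟨ x∙yz≈y∙xz (suc r) m _ ⟩
  m * (suc r * (suc (m + r) C suc r))    ≡⟨ cong (m *_) ([1+k]*[1+n]C[1+k]≡[1+n]*nCk (m + r) r) ⟩
  m * (suc (m + r) * ((m + r) C r))      ≡⟨ cong (λ x → m * (suc (m + r) * x)) ([m+n]Cm≡[m+n]Cn m r) ⟨
  m * (suc (m + r) * ((m + r) C m))      ≡⟨ x∙yz≈y∙xz m (suc (m + r)) _ ⟩
  suc (m + r) * leibniz r m              ∎
  where open ≡-Reasoning

-- The hypotheses say 1/a = 1/b + 1/c, so L/c = L/a − L/b is an integer.
∣-harmonic : ∀ m r s {a b c L} .{{_ : NonZero r}} → s ≡ m + r →
             m * b ≡ s * a → r * c ≡ s * a → a ∣ L → b ∣ L → c ∣ L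
∣-harmonic m r s {a} {b} {c} {L} s≡m+r mb≡sa rc≡sa (divides x L≡xa) (divides y L≡yb) =
  ∣m+n∣m⇒∣n (subst (c ∣_) cx≡cy+L (m∣m*n x)) (m∣m*n y)
  where
  open ≡-Reasoning
  cx≡cy+L : c * x ≡ c * y + L
  cx≡cy+L = *-cancelˡ-≡ _ _ r (begin
    r * (c * x)           ≡⟨ *-assoc r c x ⟨
    r * c * x             ≡⟨ cong (_* x) rc≡sa ⟩
    s * a * x             ≡⟨ *-assoc s a x ⟩
    s * (a * x)           ≡⟨ cong (s *_) (trans (*-comm a x) (sym L≡xa)) ⟩
    s * L                 ≡⟨ cong (_* L) s≡m+r ⟩
    (m + r) * L           ≡⟨ *-distribʳ-+ L m r ⟩
    m * L + r * L         ≡⟨ cong (λ z → m * z + r * L) L≡yb ⟩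
    m * (y * b) + r * L   ≡⟨ cong (_+ r * L) (x∙yz≈y∙xz m y b) ⟩
    y * (m * b) + r * L   ≡⟨ cong (λ z → y * z + r * L) (trans mb≡sa (sym rc≡sa)) ⟩
    y * (r * c) + r * L   ≡⟨ regroup r c y L ⟩
    r * (c * y + L)       ∎)
    where
    regroup : ∀ r c y L → y * (r * c) + r * L ≡ r * (c * y + L)
    regroup = solve-∀

leibniz-∣ : ∀ r m {L} → (∀ j → m ≤ j → j ≤ m + r → j ∣ L) → leibniz r m ∣ L
leibniz-∣ zero m {L} ∣L = subst (_∣ L) (sym leibniz0m≡m) (∣L m ≤-refl (m≤m+n m 0))
  where
  leibniz0m≡m : leibniz 0 m ≡ m
  leibniz0m≡m = trans (cong (λ x → m * (x C m)) (+-identityʳ m)) (trans (cong (m *_) (nCn≡1 m)) (*-identityʳ m))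
leibniz-∣ (suc r) m ∣L =
  ∣-harmonic m (suc r) (suc (m + r)) (sym (+-suc m r)) (leibniz-sucʳ r m) (leibniz-sucˡ r m)
    (leibniz-∣ r m (λ j m≤j j≤m+r → ∣L j m≤j (≤-trans j≤m+r (+-monoʳ-≤ m (n≤1+n r)))))
    (leibniz-∣ r (suc m) (λ j m<j j≤1+m+r → ∣L j (<⇒≤ m<j) (≤-trans j≤1+m+r (≤-reflexive (sym (+-suc m r))))))

4^[1+k]≤2*leibniz[1+k,1+k] : ∀ k → 4 ^ suc k ≤ 2 * leibniz (suc k) (suc k)
4^[1+k]≤2*leibniz[1+k,1+k] zero = ≤-refl
4^[1+k]≤2*leibniz[1+k,1+k] (suc j) =
  ≤-trans (*-monoʳ-≤ 4 (4^[1+k]≤2*leibniz[1+k,1+k] j)) (*-cancelˡ-≤ (k * suc k) (begin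
    k * suc k * (4 * (2 * leibniz k k))               ≡⟨ regroup k (leibniz k k) ⟩
    2 * suc (k + suc k) * ((k + k) * leibniz k k)     ≤⟨ *-monoʳ-≤ (2 * suc (k + suc k)) (*-monoˡ-≤ (leibniz k k) (n≤1+n (k + k))) ⟩
    2 * suc (k + suc k) * (suc (k + k) * leibniz k k) ≡⟨ cong (2 * suc (k + suc k) *_) (leibniz-sucˡ k k) ⟨
    2 * suc (k + suc k) * (suc k * leibniz (suc k) k) ≡⟨ swap (suc (k + suc k)) (suc k) (leibniz (suc k) k) ⟩
    2 * suc k * (suc (k + suc k) * leibniz (suc k) k) ≡⟨ cong (2 * suc k *_) (leibniz-sucʳ (suc k) k) ⟨
    2 * suc k * (k * leibniz (suc k) (suc k))         ≡⟨ collect k (leibniz (suc k) (suc k)) ⟩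
    k * suc k * (2 * leibniz (suc k) (suc k))         ∎))
  where
  open ≤-Reasoning
  k : ℕ
  k = suc j
  regroup : ∀ k x → k * suc k * (4 * (2 * x)) ≡ 2 * suc (k + suc k) * ((k + k) * x)
  regroup = solve-∀
  swap : ∀ a b x → 2 * a * (b * x) ≡ 2 * b * (a * x)
  swap = solve-∀
  collect : ∀ k x → 2 * suc k * (k * x) ≡ k * suc k * (2 * x)
  collect = solve-∀

-- Counting primes

primesBelow : ℕ → List ℕ
primesBelow n = filter prime? (downFrom n)

primeCount : ℕ → ℕ
primeCount n = length (primesBelow n)

∈-primesBelow⁻ : ∀ {n p} → p ∈ primesBelow n → Prime p × p < n
∈-primesBelow⁻ p∈ with p∈downFrom , prime-p ← ∈-filter⁻ prime? p∈ = prime-p , ∈-downFrom⁻ p∈downFrom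

primesBelow-unique : ∀ n → Unique (primesBelow n)
primesBelow-unique n = Unique.filter⁺ prime? (Unique.downFrom⁺ n)

lookup-injective : ∀ {A : Set} {xs : List A} → Unique xs → Injective _≡_ _≡_ (lookup xs)
lookup-injective (_    ∷ _) {zero}  {zero}  _  = refl
lookup-injective (x∉xs ∷ _) {zero}  {suc j} eq = ⊥-elim (All.lookup x∉xs (∈-lookup j) eq)
lookup-injective (x∉xs ∷ _) {suc i} {zero}  eq = ⊥-elim (All.lookup x∉xs (∈-lookup i) (sym eq))
lookup-injective (_    ∷ u) {suc i} {suc j} eq = cong suc (lookup-injective u eq)

distinctPrimesBelow : ∀ {d N} → d ≤ primeCount N →
                      Σ[ q ∈ (Fin d → ℕ) ] Injective _≡_ _≡_ q × (∀ u → Prime (q u) × q u < N)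
distinctPrimesBelow {d} {N} d≤π =
  lookup (primesBelow N) ∘ position ,
  (λ eq → inject≤-injective d≤π d≤π _ _ (lookup-injective (primesBelow-unique N) eq)) ,
  (λ u → ∈-primesBelow⁻ (∈-lookup (position u)))
  where
  position : Fin d → Fin (primeCount N)
  position u = inject≤ u d≤π

primeCount-suc : ∀ n → primeCount n ≤ primeCount (suc n)
primeCount-suc n with prime? n
... | yes _ = n≤1+n (primeCount n)
... | no  _ = ≤-refl

primeCount-mono : ∀ {m n} → m ≤ n → primeCount m ≤ primeCount n
primeCount-mono m≤n = go (≤⇒≤′ m≤n)
  where
  go : ∀ {m n} → m ≤′ n → primeCount m ≤ primeCount n
  go ≤′-refl       = ≤-refl
  go {n = suc n} (≤′-step m≤n) = ≤-trans (go m≤n) (primeCount-suc n)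

prime≥2 : ∀ {p} → Prime p → 2 ≤ p
prime≥2 {p} prime-p = nonTrivial⇒n>1 p {{prime⇒nonTrivial prime-p}}

primes-coprime : ∀ {p q} → Prime p → Prime q → p ≢ q → Coprime p q
primes-coprime {p} {q} prime-p prime-q p≢q with <-cmp p q
... | tri< p<q _ _ = Coprime.sym (prime⇒coprime prime-q ⦃ >-nonZero (≤-trans (s≤s z≤n) (prime≥2 prime-p)) ⦄ p<q)
... | tri≈ _ p≡q _ = ⊥-elim (p≢q p≡q)
... | tri> _ _ q<p = prime⇒coprime prime-p ⦃ >-nonZero (≤-trans (s≤s z≤n) (prime≥2 prime-q)) ⦄ q<p

∃prime∣ : ∀ j → 2 ≤ j → ∃ λ p → Prime p × p ∣ j
∃prime∣ (suc zero) (s≤s ())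
∃prime∣ j@(suc (suc _)) _ with factorise j
... | record { factors = [] ; isFactorisation = () }
... | record { factors = p ∷ _ ; isFactorisation = j≡∏ ; factorsPrime = prime-p ∷ _ } =
  p , prime-p , subst (p ∣_) (sym j≡∏) (m∣m*n _)

factorOut : ∀ {p} → 2 ≤ p → ∀ j → 0 < j → ∃₂ λ e r → j ≡ p ^ e * r × p ∤ r
factorOut {p} p≥2 j j>0 = go j j>0 (<-wellFounded j)
  where
  go : ∀ j → 0 < j → Acc _<_ j → ∃₂ λ e r → j ≡ p ^ e * r × p ∤ r
  go j j>0 (acc rec) with p ∣? j
  ... | no p∤j = 0 , j , sym (+-identityʳ j) , p∤j
  ... | yes (divides q j≡qp) = onceMore (go q q>0 (rec q<j))
    where
    q>0 : 0 < q
    q>0 = n≢0⇒n>0 (λ { refl → <⇒≢ j>0 (sym j≡qp) })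
    q<j : q < j
    q<j = subst (q <_) (sym j≡qp) (m<m*n q p ⦃ >-nonZero q>0 ⦄ p≥2)
    regroup : ∀ a r p → a * r * p ≡ p * a * r
    regroup = solve-∀
    onceMore : (∃₂ λ e r → q ≡ p ^ e * r × p ∤ r) → ∃₂ λ e r → j ≡ p ^ e * r × p ∤ r
    onceMore (e , r , q≡pᵉr , p∤r) = suc e , r , trans j≡qp (trans (cong (_* p) q≡pᵉr) (regroup (p ^ e) r p)) , p∤r

-- The largest power of p not exceeding X, provided the fuel f is at least X.
maxPower : (p X f : ℕ) → ℕ
maxPower zero    X f       = 1
maxPower (suc p) X zero    = 1
maxPower (suc p) X (suc f) with suc p ≤? X
... | yes _ = suc p * maxPower (suc p) (X / suc p) f
... | no  _ = 1

maxPower>0 : ∀ p X f → 0 < maxPower p X f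
maxPower>0 zero    X f       = s≤s z≤n
maxPower>0 (suc p) X zero    = s≤s z≤n
maxPower>0 (suc p) X (suc f) with suc p ≤? X
... | yes _ = *-mono-< {0} {suc p} (s≤s z≤n) (maxPower>0 (suc p) (X / suc p) f)
... | no  _ = s≤s z≤n

maxPower≤ : ∀ p X f → 0 < X → maxPower p X f ≤ X
maxPower≤ zero    X f       X>0 = X>0
maxPower≤ (suc p) X zero    X>0 = X>0
maxPower≤ (suc p) X (suc f) X>0 with suc p ≤? X
... | no  _   = X>0
... | yes p≤X = begin
  suc p * maxPower (suc p) (X / suc p) f ≤⟨ *-monoʳ-≤ (suc p) (maxPower≤ (suc p) (X / suc p) f (m≥n⇒m/n>0 p≤X)) ⟩
  suc p * (X / suc p)                    ≡⟨ *-comm (suc p) (X / suc p) ⟩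
  X / suc p * suc p                      ≤⟨ m/n*n≤m X (suc p) ⟩
  X                                      ∎
  where open ≤-Reasoning

^∣maxPower : ∀ {p} e X f → 2 ≤ p → p ^ e ≤ X → X ≤ f → p ^ e ∣ maxPower p X f
^∣maxPower zero X f _ _ _ = 1∣ _
^∣maxPower {suc p} (suc e) X zero p≥2 pᵉ⁺¹≤X X≤0 =
  ⊥-elim (<⇒≱ (≤-trans p≥2 (≤-trans (m≤m*n (suc p) (suc p ^ e) ⦃ >-nonZero (m^n>0 (suc p) e) ⦄) pᵉ⁺¹≤X)) (≤-trans X≤0 z≤n))
^∣maxPower {suc p} (suc e) X (suc f) p≥2 pᵉ⁺¹≤X X≤1+f with suc p ≤? X
... | no  p≰X = ⊥-elim (p≰X (≤-trans (m≤m*n (suc p) (suc p ^ e) ⦃ >-nonZero (m^n>0 (suc p) e) ⦄) pᵉ⁺¹≤X))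
... | yes p≤X = *-monoʳ-∣ (suc p) (^∣maxPower e (X / suc p) f p≥2 pᵉ≤X/p X/p≤f)
  where
  pᵉ≤X/p : suc p ^ e ≤ X / suc p
  pᵉ≤X/p = begin
    suc p ^ e                    ≡⟨ m*n/n≡m (suc p ^ e) (suc p) ⟨
    suc p ^ e * suc p / suc p    ≤⟨ /-monoˡ-≤ (suc p) (≤-trans (≤-reflexive (*-comm (suc p ^ e) (suc p))) pᵉ⁺¹≤X) ⟩
    X / suc p                    ∎
    where open ≤-Reasoning
  X/p≤f : X / suc p ≤ f
  X/p≤f = s≤s⁻¹ (≤-trans (m/n<m X (suc p) ⦃ >-nonZero (≤-trans (s≤s z≤n) p≤X) ⦄ p≥2) X≤1+f)

primePowerProduct : ℕ → ℕ → ℕ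
primePowerProduct X Y = product (map (λ p → maxPower p X X) (primesBelow Y))

primePowerProduct>0 : ∀ X Y → 0 < primePowerProduct X Y
primePowerProduct>0 X Y = go (primesBelow Y)
  where
  go : ∀ ps → 0 < product (map (λ p → maxPower p X X) ps)
  go []       = s≤s z≤n
  go (p ∷ ps) = *-mono-< (maxPower>0 p X X) (go ps)

primePowerProduct≤ : ∀ X Y → 0 < X → primePowerProduct X Y ≤ X ^ primeCount Y
primePowerProduct≤ X Y X>0 = go (primesBelow Y)
  where
  go : ∀ ps → product (map (λ p → maxPower p X X) ps) ≤ X ^ length ps
  go []       = ≤-refl
  go (p ∷ ps) = *-mono-≤ (maxPower≤ p X X X>0) (go ps)

∣primePowerProduct : ∀ X Y {j} → 0 < j → j ≤ X → (∀ p → Prime p → p ∣ j → p < Y) → j ∣ primePowerProduct X Y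
∣primePowerProduct X zero {suc zero} _ _ _ = 1∣ _
∣primePowerProduct X zero {suc (suc j)} _ _ factors<0 with p , prime-p , p∣j ← ∃prime∣ (2 + j) (s≤s (s≤s z≤n)) =
  ⊥-elim (<⇒≱ (factors<0 p prime-p p∣j) z≤n)
∣primePowerProduct X (suc Y) {j} j>0 j≤X factors≤Y with prime? Y
... | no ¬prime-Y = ∣primePowerProduct X Y j>0 j≤X (λ p prime-p p∣j → ≤∧≢⇒< (s≤s⁻¹ (factors≤Y p prime-p p∣j)) λ { refl → ¬prime-Y prime-p })
... | yes prime-Y with e , r , j≡Yᵉr , Y∤r ← factorOut (prime≥2 prime-Y) j j>0 =
  subst (_∣ maxPower Y X X * primePowerProduct X Y) (sym j≡Yᵉr)
    (*-pres-∣ (^∣maxPower e X X (prime≥2 prime-Y) Yᵉ≤X ≤-refl) (∣primePowerProduct X Y r>0 (≤-trans r≤j j≤X) factors<Y))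
  where
  r∣j : r ∣ j
  r∣j = divides (Y ^ e) j≡Yᵉr
  r>0 : 0 < r
  r>0 = n≢0⇒n>0 λ { refl → <⇒≢ j>0 (sym (trans j≡Yᵉr (*-zeroʳ (Y ^ e)))) }
  r≤j : r ≤ j
  r≤j = ∣⇒≤ ⦃ >-nonZero j>0 ⦄ r∣j
  Yᵉ≤X : Y ^ e ≤ X
  Yᵉ≤X = ≤-trans (∣⇒≤ ⦃ >-nonZero j>0 ⦄ (divides r (trans j≡Yᵉr (*-comm (Y ^ e) r)))) j≤X
  factors<Y : ∀ p → Prime p → p ∣ r → p < Y
  factors<Y p prime-p p∣r = ≤∧≢⇒< (s≤s⁻¹ (factors≤Y p prime-p (∣-trans p∣r r∣j))) λ { refl → Y∤r p∣r }

chebyshev : ∀ k → 0 < k → 4 ^ k ≤ 2 * (k + k) ^ primeCount (suc (k + k))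
chebyshev (suc k) _ = begin
  4 ^ suc k                                   ≤⟨ 4^[1+k]≤2*leibniz[1+k,1+k] k ⟩
  2 * leibniz (suc k) (suc k)                 ≤⟨ *-monoʳ-≤ 2 (∣⇒≤ ⦃ >-nonZero (primePowerProduct>0 X (suc X)) ⦄ leibniz∣product) ⟩
  2 * primePowerProduct X (suc X)             ≤⟨ *-monoʳ-≤ 2 (primePowerProduct≤ X (suc X) (s≤s z≤n)) ⟩
  2 * X ^ primeCount (suc X)                  ∎
  where
  open ≤-Reasoning
  X : ℕ
  X = suc k + suc k
  leibniz∣product : leibniz (suc k) (suc k) ∣ primePowerProduct X (suc X)
  leibniz∣product = leibniz-∣ (suc k) (suc k) λ j k<j j≤X →
    ∣primePowerProduct X (suc X) (≤-trans (s≤s z≤n) k<j) j≤X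
      λ p _ p∣j → s≤s (≤-trans (∣⇒≤ ⦃ >-nonZero (≤-trans (s≤s z≤n) k<j) ⦄ p∣j) j≤X)

2b[b+1]≤2^b : ∀ b → 7 ≤ b → b * suc b + b * suc b ≤ 2 ^ b
2b[b+1]≤2^b b 7≤b = go (≤⇒≤′ 7≤b)
  where
  go : ∀ {b} → 7 ≤′ b → b * suc b + b * suc b ≤ 2 ^ b
  go ≤′-refl = m≤m+n 112 16
  go {suc b} (≤′-step 7≤′b) = begin
    suc b * suc (suc b) + suc b * suc (suc b) ≡⟨ expand b ⟩
    (2 + b) * (2 * suc b)                     ≤⟨ *-monoˡ-≤ (2 * suc b) (+-monoˡ-≤ b (≤-trans (s≤s (s≤s z≤n)) (≤′⇒≤ 7≤′b))) ⟩
    (b + b) * (2 * suc b)                     ≡⟨ collect b ⟩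
    2 * (b * suc b + b * suc b)               ≤⟨ *-monoʳ-≤ 2 (go 7≤′b) ⟩
    2 * 2 ^ b                                 ∎
    where
    open ≤-Reasoning
    expand : ∀ b → suc b * suc (suc b) + suc b * suc (suc b) ≡ (2 + b) * (2 * suc b)
    expand = solve-∀
    collect : ∀ b → (b + b) * (2 * suc b) ≡ 2 * (b * suc b + b * suc b)
    collect = solve-∀

2+2b≤primeCount[1+2b[b+1]] : ∀ b → 7 ≤ b → 2 + (b + b) ≤ primeCount (suc (b * suc b + b * suc b))
2+2b≤primeCount[1+2b[b+1]] b 7≤b = ≮⇒≥ λ c<2+2b → <⇒≱ (≤-trans (s≤s (s≤s z≤n)) 7≤b) (+-cancelˡ-≤ (b * suc (b + b)) b 1 (begin
  b * suc (b + b) + b     ≡⟨ regroup b ⟩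
  k + k                   ≤⟨ 2k≤1+bc ⟩
  suc (b * c)             ≤⟨ s≤s (*-monoʳ-≤ b (s≤s⁻¹ c<2+2b)) ⟩
  suc (b * suc (b + b))   ≡⟨ +-comm 1 _ ⟩
  b * suc (b + b) + 1     ∎))
  where
  open ≤-Reasoning
  k X c : ℕ
  k = b * suc b
  X = k + k
  c = primeCount (suc X)
  regroup : ∀ b → b * suc (b + b) + b ≡ b * suc b + b * suc b
  regroup = solve-∀
  2ᵏ⁺ᵏ≤2ᵇᶜ⁺¹ : 2 ^ (k + k) ≤ 2 ^ suc (b * c)
  2ᵏ⁺ᵏ≤2ᵇᶜ⁺¹ = begin
    2 ^ (k + k)        ≡⟨ cong (λ x → 2 ^ (k + x)) (+-identityʳ k) ⟨
    2 ^ (2 * k)        ≡⟨ ^-*-assoc 2 2 k ⟨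
    4 ^ k              ≤⟨ chebyshev k (<-≤-trans (≤-trans (s≤s z≤n) 7≤b) (m≤m*n b (suc b))) ⟩
    2 * X ^ c          ≤⟨ *-monoʳ-≤ 2 (^-monoˡ-≤ c (2b[b+1]≤2^b b 7≤b)) ⟩
    2 * (2 ^ b) ^ c    ≡⟨ cong (2 *_) (^-*-assoc 2 b c) ⟩
    2 * 2 ^ (b * c)    ∎
  2k≤1+bc : k + k ≤ suc (b * c)
  2k≤1+bc = ≮⇒≥ λ 1+bc<2k → <⇒≱ (^-monoʳ-< 2 (s≤s (s≤s z≤n)) 1+bc<2k) 2ᵏ⁺ᵏ≤2ᵇᶜ⁺¹

1+2b[b+1]≤[2+2b]C2 : ∀ b → suc (b * suc b + b * suc b) ≤ (2 + (b + b)) C 2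
1+2b[b+1]≤[2+2b]C2 b = *-cancelˡ-≤ 2 (begin
  2 * suc (b * suc b + b * suc b)              ≤⟨ m≤m+n _ (b + b) ⟩
  2 * suc (b * suc b + b * suc b) + (b + b)    ≡⟨ regroup b ⟩
  suc (suc (b + b)) * suc (b + b)              ≡⟨ 2*[1+n]C2≡[1+n]*n (suc (b + b)) ⟨
  2 * ((2 + (b + b)) C 2)                      ∎)
  where
  open ≤-Reasoning
  regroup : ∀ b → 2 * suc (b * suc b + b * suc b) + (b + b) ≡ suc (suc (b + b)) * suc (b + b)
  regroup = solve-∀

even⊎odd : ∀ n → ∃[ a ] (n ≡ a + a ⊎ n ≡ suc (a + a))
even⊎odd zero = 0 , inj₁ refl
even⊎odd (suc n) with even⊎odd n
... | a , inj₁ n≡2a   = a , inj₂ (cong suc n≡2a)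
... | a , inj₂ n≡1+2a = suc a , inj₁ (cong suc (trans n≡1+2a (sym (+-suc a a))))

EnoughPrimes : ℕ → Set
EnoughPrimes n = pred n ≤ primeCount (n C 2)

enoughPrimes-small : ∀ (i : Fin 12) → EnoughPrimes (4 + toℕ i)
enoughPrimes-small = toWitness {a? = all? λ i → 3 + toℕ i ≤? primeCount ((4 + toℕ i) C 2)} _

enoughPrimes-large : ∀ b → 7 ≤ b → EnoughPrimes (2 + (b + b)) × EnoughPrimes (3 + (b + b))
enoughPrimes-large b 7≤b = ≤-trans (n≤1+n _) even , ≤-trans even (primeCount-mono (nC2≤[1+n]C2 (2 + (b + b))))
  where
  even : 2 + (b + b) ≤ primeCount ((2 + (b + b)) C 2)
  even = ≤-trans (2+2b≤primeCount[1+2b[b+1]] b 7≤b) (primeCount-mono (1+2b[b+1]≤[2+2b]C2 b))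

enoughPrimes : ∀ k → EnoughPrimes (4 + k)
enoughPrimes k with k <? 12
... | yes k<12 = subst (λ k → EnoughPrimes (4 + k)) (toℕ-fromℕ< k<12) (enoughPrimes-small (fromℕ< k<12))
... | no  k≮12 = subst (λ k → EnoughPrimes (4 + k)) (m+[n∸m]≡n (≮⇒≥ k≮12)) (beyond12 (k ∸ 12) (even⊎odd (k ∸ 12)))
  where
  beyond12 : ∀ j → ∃[ a ] (j ≡ a + a ⊎ j ≡ suc (a + a)) → EnoughPrimes (16 + j)
  beyond12 j (a , inj₁ refl) = subst EnoughPrimes (shift a) (proj₁ (enoughPrimes-large (7 + a) (m≤m+n 7 a)))
    where
    shift : ∀ a → 2 + ((7 + a) + (7 + a)) ≡ 16 + (a + a)
    shift = solve-∀
  beyond12 j (a , inj₂ refl) = subst EnoughPrimes (shift a) (proj₂ (enoughPrimes-large (7 + a) (m≤m+n 7 a)))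
    where
    shift : ∀ a → 3 + ((7 + a) + (7 + a)) ≡ 16 + suc (a + a)
    shift = solve-∀

-- The complete graph

length-filter-map : ∀ {A B : Set} {P : B → Set} (P? : ∀ x → Dec (P x)) (f : A → B) xs →
                    length (filter P? (map f xs)) ≡ length (filter (P? ∘ f) xs)
length-filter-map P? f [] = refl
length-filter-map P? f (x ∷ xs) with does (P? (f x))
... | true  = cong suc (length-filter-map P? f xs)
... | false = length-filter-map P? f xs

length-filter-<-allFin : ∀ n k → length (filter (λ (j : Fin n) → k <? toℕ j) (allFin n)) ≡ n ∸ suc k
length-filter-<-allFin zero    k       = refl
length-filter-<-allFin (suc n) zero    =
  trans (cong length (filter-all (λ j → 0 <? toℕ j) (All.tabulate⁺ {n = n} {f = Fin.suc} λ _ → s≤s z≤n))) (length-tabulate {n = n} Fin.suc)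
length-filter-<-allFin (suc n) (suc k) = begin
  length (filter (λ j → suc k <? toℕ j) (tabulate {n = n} Fin.suc))  ≡⟨ cong (length ∘ filter (λ j → suc k <? toℕ j)) (map-tabulate {n = n} (λ j → j) suc) ⟨
  length (filter (λ j → suc k <? toℕ j) (map suc (allFin n)))      ≡⟨ length-filter-map (λ j → suc k <? toℕ j) suc (allFin n) ⟩
  length (filter (λ j → suc k <? suc (toℕ j)) (allFin n))          ≡⟨ cong length (filter-≐ _ _ (s<s⁻¹ , s<s) (allFin n)) ⟩
  length (filter (λ j → k <? toℕ j) (allFin n))                    ≡⟨ length-filter-<-allFin n k ⟩
  n ∸ suc k                                                        ∎
  where open ≡-Reasoning

length-concatMap : ∀ {A B : Set} (f : A → List B) xs → length (concatMap f xs) ≡ sum (map (length ∘ f) xs)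
length-concatMap f []       = refl
length-concatMap f (x ∷ xs) = trans (length-++ (f x)) (cong (length (f x) +_) (length-concatMap f xs))

sum-tabulate-[n∸1+i] : ∀ n → sum (tabulate {n = n} λ i → n ∸ suc (toℕ i)) ≡ n C 2
sum-tabulate-[n∸1+i] zero    = refl
sum-tabulate-[n∸1+i] (suc n) = trans (cong (n +_) (sum-tabulate-[n∸1+i] n)) (sym ([1+n]C2≡n+nC2 n))

K-row : ∀ n → Fin n → List (Fin n × Fin n)
K-row n i = map (i ,_) (filter (λ j → toℕ i <? toℕ j) (allFin n))

size-K : ∀ n → size (K n) ≡ n C 2
size-K n = begin
  length (concatMap (K-row n) (allFin n))                 ≡⟨ length-concatMap (K-row n) (allFin n) ⟩
  sum (map (length ∘ K-row n) (allFin n))                 ≡⟨ cong sum (map-cong length-row (allFin n)) ⟩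
  sum (map (λ i → n ∸ suc (toℕ i)) (allFin n))            ≡⟨ cong sum (map-tabulate {n = n} (λ i → i) (λ i → n ∸ suc (toℕ i))) ⟩
  sum (tabulate {n = n} λ i → n ∸ suc (toℕ i))           ≡⟨ sum-tabulate-[n∸1+i] n ⟩
  n C 2                                                   ∎
  where
  open ≡-Reasoning
  length-row : ∀ i → length (K-row n i) ≡ n ∸ suc (toℕ i)
  length-row i = trans (length-map (i ,_) (filter (λ j → toℕ i <? toℕ j) (allFin n))) (length-filter-<-allFin n (toℕ i))

module _ {n : ℕ} where

  ∈-edges-K : ∀ (i j : Fin n) → toℕ i < toℕ j → (i , j) ∈ edges (K n)
  ∈-edges-K i j i<j = ∈-concat⁺′ (∈-map⁺ (i ,_) (∈-filter⁺ (λ j → toℕ i <? toℕ j) (∈-allFin j) i<j)) (∈-map⁺ _ (∈-allFin i))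

  K-edge : ∀ (i j : Fin n) → toℕ i < toℕ j → Edge (K n)
  K-edge i j i<j = index (∈-edges-K i j i<j)

  endpoints-K-edge : ∀ i j (i<j : toℕ i < toℕ j) → endpoints (K n) (K-edge i j i<j) ≡ (i , j)
  endpoints-K-edge i j i<j = sym (lookup-index (∈-edges-K i j i<j))

  endpoints-K-< : ∀ e → toℕ (proj₁ (endpoints (K n) e)) < toℕ (proj₂ (endpoints (K n) e))
  endpoints-K-< e
    with _ , e∈row , row∈rows ← ∈-concat⁻′ (map (K-row n) (allFin n)) (∈-lookup {xs = edges (K n)} e)
    with i , _ , refl ← ∈-map⁻ (K-row n) row∈rows
    with j , j∈ , e≡ij ← ∈-map⁻ (i ,_) e∈row =
    subst (λ (i , j) → toℕ i < toℕ j) (sym e≡ij) (proj₂ (∈-filter⁻ (λ j → toℕ i <? toℕ j) {xs = allFin n} j∈))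

∈-incident : ∀ (G : Graph) e v → proj₁ (endpoints G e) ≡ v ⊎ proj₂ (endpoints G e) ≡ v → e ∈ incident G v
∈-incident G e v = ∈-filter⁺ (λ e → (proj₁ (endpoints G e) ≟ v) ⊎-dec (proj₂ (endpoints G e) ≟ v)) (∈-allFin e)

gcdList∣ : ∀ {x xs} → x ∈ xs → gcdList xs ∣ x
gcdList∣ {xs = y ∷ ys} (here refl) = gcd[m,n]∣m y (gcdList ys)
gcdList∣ {xs = y ∷ ys} (there x∈ys) = ∣-trans (gcd[m,n]∣n y (gcdList ys)) (gcdList∣ x∈ys)

gcdList-consecutive : ∀ {a xs} → a ∈ xs → suc a ∈ xs → gcdList xs ≡ 1
gcdList-consecutive {a} {xs} a∈xs 1+a∈xs = ∣1⇒≡1 (∣m+n∣m⇒∣n (subst (gcdList xs ∣_) (+-comm 1 a) (gcdList∣ 1+a∈xs)) (gcdList∣ a∈xs))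

-- Extending injections to bijections

transpose[i,j]i≡j : ∀ {N} (i j : Fin N) → PC.transpose i j i ≡ j
transpose[i,j]i≡j i j rewrite dec-true (i ≟ i) refl = refl

transpose[i,j]k≡k : ∀ {N} {i j k : Fin N} → k ≢ i → k ≢ j → PC.transpose i j k ≡ k
transpose[i,j]k≡k {i = i} {j} {k} k≢i k≢j rewrite dec-false (k ≟ i) k≢i | dec-false (k ≟ j) k≢j = refl

↔-injective : ∀ {A B : Set} (β : A ↔ B) → Injective _≡_ _≡_ (Inverse.to β)
↔-injective β = Injection.injective (Inverse⇒Injection β)

module _ {A : Set} {N : ℕ} where

  extendToBijection : ∀ {d} (f : Fin d → A) (g : Fin d → Fin N) → Injective _≡_ _≡_ f → Injective _≡_ _≡_ g →
                      A ↔ Fin N → Σ[ β ∈ A ↔ Fin N ] (∀ i → Inverse.to β (f i) ≡ g i)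
  extendToBijection {zero}  f g _     _     β₀ = β₀ , λ ()
  extendToBijection {suc d} f g f-inj g-inj β₀
    with β , β∘f≗g ← extendToBijection (f ∘ suc) (g ∘ suc) (Fin.suc-injective ∘ f-inj) (Fin.suc-injective ∘ g-inj) β₀ =
    transpose a (g zero) ↔-∘ β , λ where
      zero    → transpose[i,j]i≡j a (g zero)
      (suc i) → trans (cong (PC.transpose a (g zero)) (β∘f≗g i)) (transpose[i,j]k≡k (gᵢ≢a i) (gᵢ≢g₀ i))
    where
    a : Fin N
    a = Inverse.to β (f zero)
    gᵢ≢a : ∀ i → g (suc i) ≢ a
    gᵢ≢a i gᵢ≡a = Fin.0≢1+n (sym (f-inj (↔-injective β (trans (β∘f≗g i) gᵢ≡a))))
    gᵢ≢g₀ : ∀ i → g (suc i) ≢ g zero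
    gᵢ≢g₀ i = Fin.0≢1+n ∘ sym ∘ g-inj

  extendToBijectionOn : ∀ {D : Set} {d} → Fin d ↔ D → (f : D → A) (g : D → Fin N) →
                        Injective _≡_ _≡_ f → Injective _≡_ _≡_ g →
                        A ↔ Fin N → Σ[ β ∈ A ↔ Fin N ] (∀ x → Inverse.to β (f x) ≡ g x)
  extendToBijectionOn e f g f-inj g-inj β₀
    with β , β∘f≗g ← extendToBijection (f ∘ Inverse.to e) (g ∘ Inverse.to e) (↔-injective e ∘ f-inj) (↔-injective e ∘ g-inj) β₀ =
    β , λ x → subst (λ y → Inverse.to β (f y) ≡ g y) (Inverse.strictlyInverseˡ e x) (β∘f≗g (Inverse.from e x))

-- The labelling

module KTotalPrime (k : ℕ) (q : Fin (3 + k) → ℕ) (q-injective : Injective _≡_ _≡_ q)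
                    (q-prime : ∀ u → Prime (q u)) (q<m : ∀ u → q u < size (K (4 + k))) where

  n : ℕ
  n = 4 + k

  m : ℕ
  m = size (K n)

  m′ : ℕ
  m′ = pred m

  2≤m′ : 2 ≤ m′
  2≤m′ = pred-mono-≤ (≤-trans (s≤s (prime≥2 (q-prime zero))) (q<m zero))

  m≡1+m′ : m ≡ suc m′
  m≡1+m′ = sym (suc-pred m ⦃ >-nonZero (≤-trans (s≤s z≤n) (q<m zero)) ⦄)

  vertexLabel : Fin n → ℕ
  vertexLabel zero    = 1
  vertexLabel (suc u) = q u

  vertexLabels-coprime : ∀ {x y} → x ≢ y → gcd (vertexLabel x) (vertexLabel y) ≡ 1
  vertexLabels-coprime {zero}  {y}     _   = gcd-zeroˡ (vertexLabel y)
  vertexLabels-coprime {suc u} {zero}  _   = gcd-zeroʳ (q u)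
  vertexLabels-coprime {suc u} {suc v} u≢v = coprime⇒gcd≡1 (primes-coprime (q-prime u) (q-prime v) (u≢v ∘ cong suc ∘ q-injective))

  Special : Set
  Special = Fin (suc n)

  specialEnds : Special → Fin n × Fin n
  specialEnds zero          = zero , suc (suc zero)
  specialEnds (suc zero)    = zero , fromℕ (3 + k)
  specialEnds (suc (suc u)) = inject₁ u , suc u

  slot : Special → ℕ
  slot zero          = 0
  slot (suc zero)    = n
  slot (suc (suc u)) = suc (toℕ u)

  specialEnds-< : ∀ i → toℕ (proj₁ (specialEnds i)) < toℕ (proj₂ (specialEnds i))
  specialEnds-< zero          = s≤s z≤n
  specialEnds-< (suc zero)    = s≤s z≤n
  specialEnds-< (suc (suc u)) = s≤s (≤-reflexive (toℕ-inject₁ u))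

  specialEnds-injective : Injective _≡_ _≡_ specialEnds
  specialEnds-injective {zero}          {zero}           _  = refl
  specialEnds-injective {zero}          {suc zero}       ()
  specialEnds-injective {zero}          {suc (suc zero)} ()
  specialEnds-injective {zero}          {suc (suc (suc _))} ()
  specialEnds-injective {suc zero}      {suc zero}       _  = refl
  specialEnds-injective {suc (suc u)}   {suc (suc v)}    eq with refl ← Fin.suc-injective (cong proj₂ eq) = refl

  specialEdge : Special → Edge (K n)
  specialEdge i = K-edge _ _ (specialEnds-< i)

  endpoints-specialEdge : ∀ i → endpoints (K n) (specialEdge i) ≡ specialEnds i
  endpoints-specialEdge i = endpoints-K-edge _ _ (specialEnds-< i)

  specialEdge-injective : Injective _≡_ _≡_ specialEdge
  specialEdge-injective {i} {j} eq =
    specialEnds-injective (trans (sym (endpoints-specialEdge i)) (trans (cong (endpoints (K n)) eq) (endpoints-specialEdge j)))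

  slot≤n : ∀ i → slot i ≤ n
  slot≤n zero          = z≤n
  slot≤n (suc zero)    = ≤-refl
  slot≤n (suc (suc u)) = ≤-trans (toℕ<n u) (n≤1+n (3 + k))

  slot-injective : Injective _≡_ _≡_ slot
  slot-injective {zero}        {zero}        _  = refl
  slot-injective {zero}        {suc zero}    ()
  slot-injective {zero}        {suc (suc _)} ()
  slot-injective {suc zero}    {suc zero}    _  = refl
  slot-injective {suc zero}    {suc (suc u)} eq = ⊥-elim (<⇒≢ (toℕ<n u) (sym (suc-injective eq)))
  slot-injective {suc (suc u)} {suc zero}    eq = ⊥-elim (<⇒≢ (toℕ<n u) (suc-injective eq))
  slot-injective {suc (suc u)} {suc (suc v)} eq with refl ← toℕ-injective (suc-injective eq) = refl

  Touches : Fin n → Fin n × Fin n → Set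
  Touches v e = proj₁ e ≡ v ⊎ proj₂ e ≡ v

  consecutiveSlotsAt : ∀ v → Σ[ i ∈ Special ] Σ[ j ∈ Special ]
                         slot j ≡ suc (slot i) × Touches v (specialEnds i) × Touches v (specialEnds j)
  consecutiveSlotsAt zero = zero , suc (suc zero) , refl , inj₁ refl , inj₁ refl
  consecutiveSlotsAt (suc u) with view u
  ... | ‵fromℕ     = suc (suc (fromℕ (2 + k))) , suc zero , cong (2 +_) (sym (toℕ-fromℕ (2 + k))) , inj₂ refl , inj₂ refl
  ... | ‵inject₁ u = suc (suc (inject₁ u)) , suc (suc (suc u)) , cong (2 +_) (sym (toℕ-inject₁ u)) , inj₂ refl , inj₁ refl

  vertexTarget : Fin n → ℕ
  vertexTarget = pred ∘ vertexLabel

  vertexLabel>0 : ∀ v → 0 < vertexLabel v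
  vertexLabel>0 zero    = s≤s z≤n
  vertexLabel>0 (suc u) = ≤-trans (s≤s z≤n) (prime≥2 (q-prime u))

  vertexTarget<m′ : ∀ v → vertexTarget v < m′
  vertexTarget<m′ zero    = ≤-trans (s≤s z≤n) 2≤m′
  vertexTarget<m′ (suc u) = pred-mono-< ⦃ >-nonZero (vertexLabel>0 (suc u)) ⦄ (subst (q u <_) m≡1+m′ (q<m u))

  vertexLabel-injective : Injective _≡_ _≡_ vertexLabel
  vertexLabel-injective {zero}  {zero}  _   = refl
  vertexLabel-injective {zero}  {suc u} 1≡q = ⊥-elim (<⇒≢ (prime≥2 (q-prime u)) 1≡q)
  vertexLabel-injective {suc u} {zero}  q≡1 = ⊥-elim (<⇒≢ (prime≥2 (q-prime u)) (sym q≡1))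
  vertexLabel-injective {suc u} {suc v} q≡q = cong suc (q-injective q≡q)

  suc-vertexTarget : ∀ v → suc (vertexTarget v) ≡ vertexLabel v
  suc-vertexTarget v = suc-pred (vertexLabel v) ⦃ >-nonZero (vertexLabel>0 v) ⦄

  vertexTarget-injective : Injective _≡_ _≡_ vertexTarget
  vertexTarget-injective {x} {y} eq =
    vertexLabel-injective (trans (sym (suc-vertexTarget x)) (trans (cong suc eq) (suc-vertexTarget y)))

  specialTarget : Special → ℕ
  specialTarget i = m′ + slot i

  target : Fin n ⊎ Special → ℕ
  target = [ vertexTarget , specialTarget ]

  target-injective : Injective _≡_ _≡_ target
  target-injective {inj₁ x} {inj₁ y} eq = cong inj₁ (vertexTarget-injective eq)
  target-injective {inj₂ i} {inj₂ j} eq = cong inj₂ (slot-injective (+-cancelˡ-≡ m′ _ _ eq))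
  target-injective {inj₁ x} {inj₂ j} eq = ⊥-elim (<⇒≱ (vertexTarget<m′ x) (subst (m′ ≤_) (sym eq) (m≤m+n m′ (slot j))))
  target-injective {inj₂ i} {inj₁ y} eq = ⊥-elim (<⇒≱ (vertexTarget<m′ y) (subst (m′ ≤_) eq (m≤m+n m′ (slot i))))

  target≤m′+n : ∀ x → target x ≤ m′ + n
  target≤m′+n (inj₁ v) = ≤-trans (<⇒≤ (vertexTarget<m′ v)) (m≤m+n m′ n)
  target≤m′+n (inj₂ i) = +-monoʳ-≤ m′ (slot≤n i)

  target<n+m : ∀ x → target x < n + m
  target<n+m x = ≤-trans (s≤s (target≤m′+n x)) (≤-reflexive (trans (cong (_+ n) (sym m≡1+m′)) (+-comm m n)))

  targetFin : Fin n ⊎ Special → Fin (n + m)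
  targetFin x = fromℕ< (target<n+m x)

  targetFin-injective : Injective _≡_ _≡_ targetFin
  targetFin-injective {x} {y} eq =
    target-injective (trans (sym (toℕ-fromℕ< (target<n+m x))) (trans (cong toℕ eq) (toℕ-fromℕ< (target<n+m y))))

  source : Fin n ⊎ Special → Vertex (K n) ⊎ Edge (K n)
  source = map₂ specialEdge

  source-injective : Injective _≡_ _≡_ source
  source-injective {inj₁ _} {inj₁ _} refl = refl
  source-injective {inj₂ _} {inj₂ _} eq   = cong inj₂ (specialEdge-injective (Sum.inj₂-injective eq))

  -- Only the specification of this bijection is ever needed, and unfolding it during
  -- conversion checking is prohibitively expensive.
  opaque
    labelling : Σ[ β ∈ (Vertex (K n) ⊎ Edge (K n)) ↔ Fin (n + m) ] (∀ x → Inverse.to β (source x) ≡ targetFin x)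
    labelling = extendToBijectionOn (+↔⊎ {n} {suc n}) source targetFin source-injective targetFin-injective (↔-sym (+↔⊎ {n} {m}))

  β : (Vertex (K n) ⊎ Edge (K n)) ↔ Fin (n + m)
  β = proj₁ labelling

  label : Vertex (K n) ⊎ Edge (K n) → ℕ
  label x = suc (toℕ (Inverse.to β x))

  label-source : ∀ x → label (source x) ≡ suc (target x)
  label-source x = cong suc (trans (cong toℕ (proj₂ labelling x)) (toℕ-fromℕ< (target<n+m x)))

  labelsAt : Fin n → List ℕ
  labelsAt v = map (label ∘ inj₂) (incident (K n) v)

  special-∈ : ∀ v i → Touches v (specialEnds i) → suc (m′ + slot i) ∈ labelsAt v
  special-∈ v i touches = subst (_∈ labelsAt v) (label-source (inj₂ i))
    (∈-map⁺ (label ∘ inj₂) (∈-incident (K n) (specialEdge i) v (subst (Touches v) (sym (endpoints-specialEdge i)) touches)))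

  incidentCoprime : ∀ v → gcdList (labelsAt v) ≡ 1
  incidentCoprime v with i , j , slotⱼ≡1+slotᵢ , touchesᵢ , touchesⱼ ← consecutiveSlotsAt v =
    gcdList-consecutive (special-∈ v i touchesᵢ)
      (subst (_∈ labelsAt v) (cong suc (trans (cong (m′ +_) slotⱼ≡1+slotᵢ) (+-suc m′ (slot i)))) (special-∈ v j touchesⱼ))

  adjacentCoprime : ∀ e → gcd (label (inj₁ (proj₁ (endpoints (K n) e)))) (label (inj₁ (proj₂ (endpoints (K n) e)))) ≡ 1
  adjacentCoprime e = subst₂ (λ a b → gcd a b ≡ 1) (sym (labelᵥ x)) (sym (labelᵥ y))
    (vertexLabels-coprime λ x≡y → <⇒≢ (endpoints-K-< {n} e) (cong toℕ x≡y))
    where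
    x y : Fin n
    x = proj₁ (endpoints (K n) e)
    y = proj₂ (endpoints (K n) e)
    labelᵥ : ∀ v → label (inj₁ v) ≡ vertexLabel v
    labelᵥ v = trans (label-source (inj₁ v)) (suc-vertexTarget v)

  totalPrime : TotalPrime (K n)
  totalPrime = record
    { bij             = β
    ; adjacentCoprime = adjacentCoprime
    ; incidentCoprime = λ v _ → incidentCoprime v
    }

K[4+k]-totalPrime : ∀ k → TotalPrime (K (4 + k))
K[4+k]-totalPrime k
  with q , q-injective , q-prime<m ← distinctPrimesBelow (subst (λ m → 3 + k ≤ primeCount m) (sym (size-K (4 + k))) (enoughPrimes k)) =
  KTotalPrime.totalPrime k q q-injective (proj₁ ∘ q-prime<m) (proj₂ ∘ q-prime<m)

mainTheorem6 : (n : ℕ) → 4 ≤ n → TotalPrime (K n)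
mainTheorem6 n 4≤n = subst (TotalPrime ∘ K) (m+[n∸m]≡n 4≤n) (K[4+k]-totalPrime (n ∸ 4))
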